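{- For $w,v\in\mathfrak{H}^{0}$ we have \begin{align*} \tau(\tau(w)*\tau(v))=w \mathbin{\sqcup\!\sqcup}_{Sh} v. \end{align*}
   Context: Let $\mathfrak{H}=\mathbb{Q}\langle x,y\rangle$, $\mathfrak{H}^0=\mathbb{Q}+x\mathfrak{H}y$, $\mathfrak{H}^1=\mathbb{Q}+\mathfrak{H}y$, and $z_k=x^{k-1}y$ for $k\ge1$, so $\mathfrak{H}^1=\mathbb{Q}\langle z_1,z_2,\dots\rangle$. The stuffle product $\ast$ on $\mathfrak{H}^1$ is defined by $z_iw\ast z_jv=z_i(w\ast z_jv)+z_j(z_iw\ast v)+z_{i+j}(w\ast v)$, ${\bf 1}\ast w=w\ast{\bf 1}=w$. $\tau$ is the $\mathbb{Q}$-linear anti-automorphism of $\mathfrak{H}$ with $\tau(x)=y$, $\tau(y)=x$, $\tau({\bf 1})={\bf 1}$. Define the commutative bilinear map $\diamond_{Sh}$ on letters $\{x,y\}$ by $x\diamond_{Sh}y=y\diamond_{Sh}x=-xy$, $y\diamond_{Sh}y=-yy$, $x\diamond_{Sh}x=xy$, and the product $\mathbin{\sqcup\!\sqcup}_{Sh}$ on $\mathfrak{H}$ by $\alpha w\mathbin{\sqcup\!\sqcup}_{Sh}\beta v=\alpha(w\mathbin{\sqcup\!\sqcup}_{Sh}\beta v)+\beta(\alpha w\mathbin{\sqcup\!\sqcup}_{Sh}v)+(\alpha\diamond_{Sh}\beta)(w\mathbin{\sqcup\!\sqcup}_{Sh}v)$ for $\alpha,\beta\in\{x,y\}$ and words $w,v$,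 with ${\bf 1}$ as unit. -}

module Defs where

open import Data.Nat using (ℕ; zero; suc) renaming (_+_ to _+ℕ_)
open import Data.List using (List; []; _∷_; map; concatMap; reverse; replicate; _++_)
open import Data.Maybe using (Maybe; just; nothing)
open import Data.Product using (_×_; _,_; proj₁; proj₂)
open import Data.Rational using (ℚ; 0ℚ; 1ℚ; _+_; _*_; -_)
open import Relation.Nullary using (¬_; yes; no)
open import Relation.Nullary.Decidable using (map′)
open import Relation.Binary.PropositionalEquality using (_≡_; refl; cong)
import Data.List.Properties as LP

data Letter : Set where
  x y : Letter

_≟L_ : (a b : Letter) → Relation.Nullary.Dec (a ≡ b)
x ≟L x = yes refl
x ≟L y = no (λ ())
y ≟L x = no (λ ())
y ≟L y = yes refl

-- Words (monomials of 𝔥 = ℚ⟨x,y⟩); the empty word is 𝟏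
Word : Set
Word = List Letter

_≟W_ : (u v : Word) → Relation.Nullary.Dec (u ≡ v)
_≟W_ = LP.≡-dec _≟L_

-- Elements of 𝔥: formal finite ℚ-linear combinations of words
Poly : Set
Poly = List (ℚ × Word)

coeff : Poly → Word → ℚ
coeff [] u = 0ℚ
coeff ((c , w) ∷ p) u with w ≟W u
... | yes _ = c + coeff p u
... | no  _ = coeff p u

infix 4 _≈_
_≈_ : Poly → Poly → Set
p ≈ q = ∀ u → coeff p u ≡ coeff q u

scale : ℚ → Poly → Poly
scale a = map (λ { (c , w) → (a * c , w) })

lmul : Word → Poly → Poly
lmul u = map (λ { (c , w) → (c , u ++ w) })

bilin : (Word → Word → Poly) → Poly → Poly → Poly
bilin f p q = concatMap (λ { (a , w) → concatMap (λ { (b , v) → scale (a * b) (f w v) }) q }) p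

swapL : Letter → Letter
swapL x = y
swapL y = x

τw : Word → Word
τw w = reverse (map swapL w)

τ : Poly → Poly
τ = map (λ { (c , w) → (c , τw w) })

-- membership in 𝔥⁰ = ℚ + x𝔥y : the word is empty or of the form x…y
data IsH0Word : Word → Set where
  empty : IsH0Word []
  xuy   : ∀ u → IsH0Word (x ∷ u ++ y ∷ [])

InH0 : Poly → Set
InH0 p = ∀ u → ¬ (coeff p u ≡ 0ℚ) → IsH0Word u

-- Stuffle product on 𝔥¹ = ℚ⟨z₁, z₂, …⟩, z_k = x^{k-1} y

-- z-words: lists of indices k (k ≥ 1)
z : ℕ → Word
z zero    = y ∷ []   -- not used for valid indices
z (suc k) = replicate k x ++ y ∷ []

zs : List ℕ → Word
zs []       = []
zs (k ∷ ks) = z k ++ zs ks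

parse : Word → Maybe (List ℕ)
parse [] = just []
parse (y ∷ w) with parse w
... | just ks = just (1 ∷ ks)
... | nothing = nothing
parse (x ∷ w) with parse w
... | just (k ∷ ks) = just (suc k ∷ ks)
... | just []       = nothing
... | nothing       = nothing

stZ : List ℕ → List ℕ → List (ℚ × List ℕ)
stZ [] v = (1ℚ , v) ∷ []
stZ (i ∷ w) [] = (1ℚ , i ∷ w) ∷ []
stZ (i ∷ w) (j ∷ v) =
  map (λ { (c , t) → (c , i ∷ t) }) (stZ w (j ∷ v)) ++
  map (λ { (c , t) → (c , j ∷ t) }) (stZ (i ∷ w) v) ++
  map (λ { (c , t) → (c , (i +ℕ j) ∷ t) }) (stZ w v)

-- stuffle of two words of 𝔥¹ (words outside 𝔥¹ give 0; never used below)
stW : Word → Word → Poly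
stW w v with parse w | parse v
... | just ks | just ls = map (λ { (c , t) → (c , zs t) }) (stZ ks ls)
... | _       | _       = []

_✶_ : Poly → Poly → Poly
_✶_ = bilin stW

-- α ⋄_Sh β, as a coefficient times a word of length 2
⋄Sh : Letter → Letter → ℚ × Word
⋄Sh x y = (- 1ℚ , x ∷ y ∷ [])
⋄Sh y x = (- 1ℚ , x ∷ y ∷ [])
⋄Sh y y = (- 1ℚ , y ∷ y ∷ [])
⋄Sh x x = (1ℚ , x ∷ y ∷ [])

shW : Word → Word → Poly
shW [] v = (1ℚ , v) ∷ []
shW (a ∷ w) [] = (1ℚ , a ∷ w) ∷ []
shW (a ∷ w) (b ∷ v) =
  lmul (a ∷ []) (shW w (b ∷ v)) ++
  lmul (b ∷ []) (shW (a ∷ w) v) ++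
  scale (proj₁ (⋄Sh a b)) (lmul (proj₂ (⋄Sh a b)) (shW w v))

_⧢Sh_ : Poly → Poly → Poly
_⧢Sh_ = bilin shW

-- A word of 𝔥⁰ is 1 or x yᵏ¹ x yᵏ² ⋯ x yᵏⁿ, and τ sends it to the z-word
-- z_{kₙ+1} ⋯ z_{k₁+1}.  Because y ⋄_Sh b = −b y, a leading y factors out of
-- ⧢_Sh, so on such words ⧢_Sh is the quasi-shuffle of the exponent lists
-- (k₁, …, kₙ) in which two blocks x yᵃ, x yᵇ merge into x y^(a+b+1)
-- (from x ⋄_Sh x = x y).  The stuffle is the quasi-shuffle of z-indices
-- under +, and k ↦ k + 1 carries the first merge rule to the second.  Finally
-- τ reverses words, and the quasi-shuffle of two reversed lists is, up to
-- the order of its terms, the reversal of their quasi-shuffle.  Both sides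
-- of the identity are bilinear, so it suffices to check it on words.

module Submission where

open import Defs

import Algebra.Solver.CommutativeMonoid as CommutativeMonoidSolver
open import Data.Empty using (⊥-elim)
open import Data.List using (List; []; _∷_; _∷ʳ_; _++_; map; concatMap; reverse; replicate; length)
import Data.List.Properties as List
open import Data.List.Relation.Binary.Permutation.Propositional as ↭ using (_↭_; ↭-refl; ↭-reflexive; module PermutationReasoning)
open import Data.List.Relation.Binary.Permutation.Propositional.Properties using (map⁺; ++⁺; ++⁺ˡ; ++⁺ʳ; shifts; ++-commutativeMonoid)
open import Data.Maybe using (just)
open import Data.Nat using (ℕ; zero; suc; _≤_; z≤n; s≤s) renaming (_+_ to _+ℕ_)
import Data.Nat.Properties as ℕ
open import Data.Product using (∃; _×_; _,_; map₂)
open import Data.Rational using (ℚ; 0ℚ; 1ℚ; _+_; _*_; -_)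
import Data.Rational.Properties as ℚ
open import Data.Rational.Solver using (module +-*-Solver)
open import Function using (_∘_)
open import Relation.Binary.Bundles using (Setoid)
open import Relation.Binary.PropositionalEquality using (_≡_; _≢_; refl; sym; trans; cong; cong₂; module ≡-Reasoning)
import Relation.Binary.Reasoning.Setoid as SetoidReasoning
open import Relation.Nullary using (yes; no)

map-++₃ : {A B : Set} (f : A → B) (X Y Z : List A) → map f (X ++ Y ++ Z) ≡ map f X ++ map f Y ++ map f Z
map-++₃ f X Y Z = trans (List.map-++ f X (Y ++ Z)) (cong (map f X ++_) (List.map-++ f Y Z))

replicate-+ : ∀ {A : Set} m n (a : A) → replicate (m +ℕ n) a ≡ replicate m a ++ replicate n a
replicate-+ zero    n a = refl
replicate-+ (suc m) n a = cong (a ∷_) (replicate-+ m n a)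

replicate-∷ʳ : ∀ {A : Set} n (a : A) → replicate n a ∷ʳ a ≡ a ∷ replicate n a
replicate-∷ʳ zero    a = refl
replicate-∷ʳ (suc n) a = cong (a ∷_) (replicate-∷ʳ n a)

reverse-replicate : ∀ {A : Set} n (a : A) → reverse (replicate n a) ≡ replicate n a
reverse-replicate zero    a = refl
reverse-replicate (suc n) a = trans (List.unfold-reverse a (replicate n a))
  (trans (cong (_∷ʳ a) (reverse-replicate n a)) (replicate-∷ʳ n a))

module QuasiShuffle {A : Set} (_∙_ : A → A → A) where

  qsh : List A → List A → List (List A)
  qsh []      L       = L ∷ []
  qsh (k ∷ K) []      = (k ∷ K) ∷ []
  qsh (k ∷ K) (l ∷ L) =
    map (k ∷_) (qsh K (l ∷ L)) ++ map (l ∷_) (qsh (k ∷ K) L) ++ map (k ∙ l ∷_) (qsh K L)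

  qsh-[]ʳ : ∀ K → qsh K [] ≡ K ∷ []
  qsh-[]ʳ []      = refl
  qsh-[]ʳ (_ ∷ _) = refl

  _◃_ : A → List (List A) → List (List A)
  k ◃ S = map (k ∷_) S

  _▹_ : List (List A) → A → List (List A)
  S ▹ i = map (_∷ʳ i) S

  private
    open CommutativeMonoidSolver (++-commutativeMonoid {A = List A}) using (solve; _⊜_; _⊕_)
    open PermutationReasoning

    ◃-▹-comm : ∀ k S i → k ◃ (S ▹ i) ≡ (k ◃ S) ▹ i
    ◃-▹-comm k S i = trans (sym (List.map-∘ S)) (List.map-∘ S)

    ◃-▹₃ : ∀ k X Y Z i j l →
           k ◃ (X ▹ i ++ Y ▹ j ++ Z ▹ l) ≡ (k ◃ X) ▹ i ++ (k ◃ Y) ▹ j ++ (k ◃ Z) ▹ l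
    ◃-▹₃ k X Y Z i j l = trans (map-++₃ (k ∷_) (X ▹ i) (Y ▹ j) (Z ▹ l))
      (cong₂ _++_ (◃-▹-comm k X i) (cong₂ _++_ (◃-▹-comm k Y j) (◃-▹-comm k Z l)))

  qsh-∷ʳ-[]ˡ : ∀ L i j →
    qsh (i ∷ []) (L ∷ʳ j) ↭ qsh [] (L ∷ʳ j) ▹ i ++ qsh (i ∷ []) L ▹ j ++ qsh [] L ▹ (i ∙ j)
  qsh-∷ʳ-[]ˡ []      i j = ↭.swap _ _ ↭-refl
  qsh-∷ʳ-[]ˡ (l ∷ L) i j = begin
      a ++ l ◃ qsh (i ∷ []) (L ∷ʳ j) ++ e
    ↭⟨ ++⁺ˡ a (++⁺ʳ e (map⁺ (l ∷_) (qsh-∷ʳ-[]ˡ L i j))) ⟩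
      a ++ l ◃ (((L ∷ʳ j) ∷ []) ▹ i ++ qsh (i ∷ []) L ▹ j ++ (L ∷ []) ▹ (i ∙ j)) ++ e
    ≡⟨ cong (λ t → a ++ t ++ e) (◃-▹₃ l ((L ∷ʳ j) ∷ []) (qsh (i ∷ []) L) (L ∷ []) i j (i ∙ j)) ⟩
      a ++ (b ++ c ++ d) ++ e
    ↭⟨ solve 5 (λ a b c d e → a ⊕ (b ⊕ c ⊕ d) ⊕ e ⊜ b ⊕ (a ⊕ c ⊕ e) ⊕ d) ↭-refl a b c d e ⟩
      b ++ (a ++ c ++ e) ++ d
    ≡⟨ cong (λ t → b ++ t ++ d) (sym (map-++₃ (_∷ʳ j) ((i ∷ l ∷ L) ∷ []) (l ◃ qsh (i ∷ []) L) (((i ∙ l) ∷ L) ∷ []))) ⟩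
      qsh [] (l ∷ L ∷ʳ j) ▹ i ++ qsh (i ∷ []) (l ∷ L) ▹ j ++ qsh [] (l ∷ L) ▹ (i ∙ j)
    ∎
    where
    a b c d e : List (List A)
    a = (i ∷ l ∷ (L ∷ʳ j)) ∷ []
    b = (l ∷ (L ∷ʳ j) ∷ʳ i) ∷ []
    c = (l ◃ qsh (i ∷ []) L) ▹ j
    d = (l ∷ L ∷ʳ (i ∙ j)) ∷ []
    e = ((i ∙ l) ∷ (L ∷ʳ j)) ∷ []

  qsh-∷ʳ-[]ʳ : ∀ K i j →
    qsh (K ∷ʳ i) (j ∷ []) ↭ qsh K (j ∷ []) ▹ i ++ qsh (K ∷ʳ i) [] ▹ j ++ qsh K [] ▹ (i ∙ j)
  qsh-∷ʳ-[]ʳ []      i j = ↭.swap _ _ ↭-refl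
  qsh-∷ʳ-[]ʳ (k ∷ K) i j with qsh-∷ʳ-[]ʳ K i j
  ... | ih rewrite qsh-[]ʳ (K ∷ʳ i) | qsh-[]ʳ K = begin
      k ◃ qsh (K ∷ʳ i) (j ∷ []) ++ d ++ e
    ↭⟨ ++⁺ʳ (d ++ e) (map⁺ (k ∷_) ih) ⟩
      k ◃ (qsh K (j ∷ []) ▹ i ++ ((K ∷ʳ i) ∷ []) ▹ j ++ (K ∷ []) ▹ (i ∙ j)) ++ d ++ e
    ≡⟨ cong (_++ d ++ e) (◃-▹₃ k (qsh K (j ∷ [])) ((K ∷ʳ i) ∷ []) (K ∷ []) i j (i ∙ j)) ⟩
      (a ++ b ++ c) ++ d ++ e
    ↭⟨ solve 5 (λ a b c d e → (a ⊕ b ⊕ c) ⊕ d ⊕ e ⊜ (a ⊕ d ⊕ e) ⊕ b ⊕ c) ↭-refl a b c d e ⟩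
      (a ++ d ++ e) ++ b ++ c
    ≡⟨ cong (_++ b ++ c) (sym (map-++₃ (_∷ʳ i) (k ◃ qsh K (j ∷ [])) ((j ∷ k ∷ K) ∷ []) ((k ∙ j) ◃ (K ∷ [])))) ⟩
      (k ◃ qsh K (j ∷ []) ++ (j ∷ k ∷ K) ∷ [] ++ (k ∙ j) ◃ (K ∷ [])) ▹ i ++ b ++ c
    ∎
    where
    a b c d e : List (List A)
    a = (k ◃ qsh K (j ∷ [])) ▹ i
    b = (k ∷ (K ∷ʳ i) ∷ʳ j) ∷ []
    c = (k ∷ K ∷ʳ (i ∙ j)) ∷ []
    d = (j ∷ k ∷ (K ∷ʳ i)) ∷ []
    e = ((k ∙ j) ∷ (K ∷ʳ i)) ∷ []

  qsh-∷ʳ : ∀ K L i j →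
    qsh (K ∷ʳ i) (L ∷ʳ j) ↭ qsh K (L ∷ʳ j) ▹ i ++ qsh (K ∷ʳ i) L ▹ j ++ qsh K L ▹ (i ∙ j)
  qsh-∷ʳ []      L       i j = qsh-∷ʳ-[]ˡ L i j
  qsh-∷ʳ (k ∷ K) []      i j = qsh-∷ʳ-[]ʳ (k ∷ K) i j
  qsh-∷ʳ (k ∷ K) (l ∷ L) i j = begin
      k ◃ qsh (K ∷ʳ i) (l ∷ L ∷ʳ j) ++ l ◃ qsh (k ∷ K ∷ʳ i) (L ∷ʳ j) ++ (k ∙ l) ◃ qsh (K ∷ʳ i) (L ∷ʳ j)
    ↭⟨ ++⁺ (map⁺ (k ∷_) (qsh-∷ʳ K (l ∷ L) i j))
           (++⁺ (map⁺ (l ∷_) (qsh-∷ʳ (k ∷ K) L i j)) (map⁺ ((k ∙ l) ∷_) (qsh-∷ʳ K L i j))) ⟩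
      k ◃ (qsh K (l ∷ L ∷ʳ j) ▹ i ++ qsh (K ∷ʳ i) (l ∷ L) ▹ j ++ qsh K (l ∷ L) ▹ (i ∙ j))
      ++ l ◃ (qsh (k ∷ K) (L ∷ʳ j) ▹ i ++ qsh (k ∷ K ∷ʳ i) L ▹ j ++ qsh (k ∷ K) L ▹ (i ∙ j))
      ++ (k ∙ l) ◃ (qsh K (L ∷ʳ j) ▹ i ++ qsh (K ∷ʳ i) L ▹ j ++ qsh K L ▹ (i ∙ j))
    ≡⟨ cong₂ _++_ (◃-▹₃ k (qsh K (l ∷ L ∷ʳ j)) (qsh (K ∷ʳ i) (l ∷ L)) (qsh K (l ∷ L)) i j (i ∙ j))
        (cong₂ _++_ (◃-▹₃ l (qsh (k ∷ K) (L ∷ʳ j)) (qsh (k ∷ K ∷ʳ i) L) (qsh (k ∷ K) L) i j (i ∙ j))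
                    (◃-▹₃ (k ∙ l) (qsh K (L ∷ʳ j)) (qsh (K ∷ʳ i) L) (qsh K L) i j (i ∙ j))) ⟩
      (A₁ ++ A₂ ++ A₃) ++ (B₁ ++ B₂ ++ B₃) ++ (C₁ ++ C₂ ++ C₃)
    ↭⟨ solve 9 (λ a₁ a₂ a₃ b₁ b₂ b₃ c₁ c₂ c₃ →
                  (a₁ ⊕ a₂ ⊕ a₃) ⊕ (b₁ ⊕ b₂ ⊕ b₃) ⊕ (c₁ ⊕ c₂ ⊕ c₃) ⊜
                  (a₁ ⊕ b₁ ⊕ c₁) ⊕ (a₂ ⊕ b₂ ⊕ c₂) ⊕ (a₃ ⊕ b₃ ⊕ c₃))
               ↭-refl A₁ A₂ A₃ B₁ B₂ B₃ C₁ C₂ C₃ ⟩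
      (A₁ ++ B₁ ++ C₁) ++ (A₂ ++ B₂ ++ C₂) ++ (A₃ ++ B₃ ++ C₃)
    ≡⟨ sym (cong₂ _++_
          (map-++₃ (_∷ʳ i) (k ◃ qsh K (l ∷ L ∷ʳ j)) (l ◃ qsh (k ∷ K) (L ∷ʳ j)) ((k ∙ l) ◃ qsh K (L ∷ʳ j)))
        (cong₂ _++_ (map-++₃ (_∷ʳ j) (k ◃ qsh (K ∷ʳ i) (l ∷ L)) (l ◃ qsh (k ∷ K ∷ʳ i) L) ((k ∙ l) ◃ qsh (K ∷ʳ i) L))
                    (map-++₃ (_∷ʳ (i ∙ j)) (k ◃ qsh K (l ∷ L)) (l ◃ qsh (k ∷ K) L) ((k ∙ l) ◃ qsh K L)))) ⟩
      qsh (k ∷ K) (l ∷ L ∷ʳ j) ▹ i ++ qsh (k ∷ K ∷ʳ i) (l ∷ L) ▹ j ++ qsh (k ∷ K) (l ∷ L) ▹ (i ∙ j)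
    ∎
    where
    A₁ A₂ A₃ B₁ B₂ B₃ C₁ C₂ C₃ : List (List A)
    A₁ = (k ◃ qsh K (l ∷ L ∷ʳ j)) ▹ i
    A₂ = (k ◃ qsh (K ∷ʳ i) (l ∷ L)) ▹ j
    A₃ = (k ◃ qsh K (l ∷ L)) ▹ (i ∙ j)
    B₁ = (l ◃ qsh (k ∷ K) (L ∷ʳ j)) ▹ i
    B₂ = (l ◃ qsh (k ∷ K ∷ʳ i) L) ▹ j
    B₃ = (l ◃ qsh (k ∷ K) L) ▹ (i ∙ j)
    C₁ = ((k ∙ l) ◃ qsh K (L ∷ʳ j)) ▹ i
    C₂ = ((k ∙ l) ◃ qsh (K ∷ʳ i) L) ▹ j
    C₃ = ((k ∙ l) ◃ qsh K L) ▹ (i ∙ j)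

  private
    map-reverse-◃ : ∀ k S → map reverse (k ◃ S) ≡ map reverse S ▹ k
    map-reverse-◃ k S =
      trans (sym (List.map-∘ S)) (trans (List.map-cong (List.unfold-reverse k) S) (List.map-∘ S))

  qsh-reverse : ∀ K L → qsh (reverse K) (reverse L) ↭ map reverse (qsh K L)
  qsh-reverse []      L       = ↭-refl
  qsh-reverse (k ∷ K) []      = ↭-reflexive (qsh-[]ʳ (reverse (k ∷ K)))
  qsh-reverse (k ∷ K) (l ∷ L) = begin
      qsh (reverse (k ∷ K)) (reverse (l ∷ L))
    ≡⟨ cong₂ qsh (List.unfold-reverse k K) (List.unfold-reverse l L) ⟩
      qsh (reverse K ∷ʳ k) (reverse L ∷ʳ l)
    ↭⟨ qsh-∷ʳ (reverse K) (reverse L) k l ⟩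
      qsh (reverse K) (reverse L ∷ʳ l) ▹ k ++ qsh (reverse K ∷ʳ k) (reverse L) ▹ l
        ++ qsh (reverse K) (reverse L) ▹ (k ∙ l)
    ≡⟨ cong₂ (λ L′ K′ → qsh (reverse K) L′ ▹ k ++ qsh K′ (reverse L) ▹ l ++ qsh (reverse K) (reverse L) ▹ (k ∙ l))
             (sym (List.unfold-reverse l L)) (sym (List.unfold-reverse k K)) ⟩
      qsh (reverse K) (reverse (l ∷ L)) ▹ k ++ qsh (reverse (k ∷ K)) (reverse L) ▹ l
        ++ qsh (reverse K) (reverse L) ▹ (k ∙ l)
    ↭⟨ ++⁺ (map⁺ (_∷ʳ k) (qsh-reverse K (l ∷ L)))
           (++⁺ (map⁺ (_∷ʳ l) (qsh-reverse (k ∷ K) L)) (map⁺ (_∷ʳ (k ∙ l)) (qsh-reverse K L))) ⟩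
      map reverse (qsh K (l ∷ L)) ▹ k ++ map reverse (qsh (k ∷ K) L) ▹ l ++ map reverse (qsh K L) ▹ (k ∙ l)
    ≡⟨ sym (cong₂ _++_ (map-reverse-◃ k (qsh K (l ∷ L)))
             (cong₂ _++_ (map-reverse-◃ l (qsh (k ∷ K) L)) (map-reverse-◃ (k ∙ l) (qsh K L)))) ⟩
      map reverse (k ◃ qsh K (l ∷ L)) ++ map reverse (l ◃ qsh (k ∷ K) L) ++ map reverse ((k ∙ l) ◃ qsh K L)
    ≡⟨ sym (map-++₃ reverse (k ◃ qsh K (l ∷ L)) (l ◃ qsh (k ∷ K) L) ((k ∙ l) ◃ qsh K L)) ⟩
      map reverse (qsh (k ∷ K) (l ∷ L))
    ∎

open QuasiShuffle using (qsh; qsh-reverse)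

qsh-map : {A B : Set} {_∙_ : A → A → A} {_⋆_ : B → B → B} (h : A → B) →
          (∀ i j → h (i ∙ j) ≡ h i ⋆ h j) →
          ∀ K L → qsh _⋆_ (map h K) (map h L) ≡ map (map h) (qsh _∙_ K L)
qsh-map h hom []      L       = refl
qsh-map h hom (k ∷ K) []      = refl
qsh-map {_∙_ = _∙_} {_⋆_} h hom (k ∷ K) (l ∷ L) = begin
    map (h k ∷_) (qsh _⋆_ (map h K) (map h (l ∷ L))) ++ map (h l ∷_) (qsh _⋆_ (map h (k ∷ K)) (map h L))
      ++ map (h k ⋆ h l ∷_) (qsh _⋆_ (map h K) (map h L))
  ≡⟨ cong₂ _++_ (cong (map (h k ∷_)) (qsh-map h hom K (l ∷ L)))
       (cong₂ _++_ (cong (map (h l ∷_)) (qsh-map h hom (k ∷ K) L))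
                   (cong₂ (λ m S → map (m ∷_) S) (sym (hom k l)) (qsh-map h hom K L))) ⟩
    map (h k ∷_) (map (map h) (qsh _∙_ K (l ∷ L))) ++ map (h l ∷_) (map (map h) (qsh _∙_ (k ∷ K) L))
      ++ map (h (k ∙ l) ∷_) (map (map h) (qsh _∙_ K L))
  ≡⟨ cong₂ _++_ (map-cons-map k (qsh _∙_ K (l ∷ L)))
       (cong₂ _++_ (map-cons-map l (qsh _∙_ (k ∷ K) L)) (map-cons-map (k ∙ l) (qsh _∙_ K L))) ⟩
    map (map h) (map (k ∷_) (qsh _∙_ K (l ∷ L))) ++ map (map h) (map (l ∷_) (qsh _∙_ (k ∷ K) L))
      ++ map (map h) (map (k ∙ l ∷_) (qsh _∙_ K L))
  ≡⟨ sym (map-++₃ (map h) (map (k ∷_) (qsh _∙_ K (l ∷ L))) (map (l ∷_) (qsh _∙_ (k ∷ K) L)) (map (k ∙ l ∷_) (qsh _∙_ K L))) ⟩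
    map (map h) (qsh _∙_ (k ∷ K) (l ∷ L))
  ∎
  where
  open ≡-Reasoning
  map-cons-map : ∀ a S → map (h a ∷_) (map (map h) S) ≡ map (map h) (map (a ∷_) S)
  map-cons-map a S = trans (sym (List.map-∘ S)) (List.map-∘ S)

coeff-++ : ∀ p q u → coeff (p ++ q) u ≡ coeff p u + coeff q u
coeff-++ []            q u = sym (ℚ.+-identityˡ _)
coeff-++ ((c , w) ∷ p) q u with w ≟W u
... | yes _ = trans (cong (c +_) (coeff-++ p q u)) (sym (ℚ.+-assoc c _ _))
... | no  _ = coeff-++ p q u

coeff-scale : ∀ a p u → coeff (scale a p) u ≡ a * coeff p u
coeff-scale a []            u = sym (ℚ.*-zeroʳ a)
coeff-scale a ((c , w) ∷ p) u with w ≟W u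
... | yes _ = trans (cong (a * c +_) (coeff-scale a p u)) (sym (ℚ.*-distribˡ-+ a c _))
... | no  _ = coeff-scale a p u

≈-setoid : Setoid _ _
≈-setoid = record
  { Carrier       = Poly
  ; _≈_           = _≈_
  ; isEquivalence = record
    { refl  = λ _ → refl
    ; sym   = λ p≈q u → sym (p≈q u)
    ; trans = λ p≈q q≈r u → trans (p≈q u) (q≈r u)
    }
  }

≡⇒≈ : ∀ {p q} → p ≡ q → p ≈ q
≡⇒≈ refl _ = refl

++-cong : ∀ p p′ q q′ → p ≈ p′ → q ≈ q′ → p ++ q ≈ p′ ++ q′
++-cong p p′ q q′ p≈p′ q≈q′ u =
  trans (coeff-++ p q u) (trans (cong₂ _+_ (p≈p′ u) (q≈q′ u)) (sym (coeff-++ p′ q′ u)))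

scale-identity : ∀ p → scale 1ℚ p ≈ p
scale-identity p u = trans (coeff-scale 1ℚ p u) (ℚ.*-identityˡ _)

↭⇒≈ : ∀ {p q} → p ↭ q → p ≈ q
↭⇒≈ ↭.refl                    u = refl
↭⇒≈ (↭.prep (c , w) p↭q)      u with w ≟W u
... | yes _ = cong (c +_) (↭⇒≈ p↭q u)
... | no  _ = ↭⇒≈ p↭q u
↭⇒≈ (↭.swap {xs = p} {ys = q} s t p↭q) u = begin
    coeff (s ∷ t ∷ p) u    ≡⟨ coeff-∷₂ s t p ⟩
    σ + (θ + coeff p u)    ≡⟨ cong (λ r → σ + (θ + r)) (↭⇒≈ p↭q u) ⟩
    σ + (θ + coeff q u)    ≡⟨ solve 3 (λ a b r → a :+ (b :+ r) := b :+ (a :+ r)) refl σ θ (coeff q u) ⟩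
    θ + (σ + coeff q u)    ≡⟨ sym (coeff-∷₂ t s q) ⟩
    coeff (t ∷ s ∷ q) u    ∎
  where
  open ≡-Reasoning
  open +-*-Solver
  σ θ : ℚ
  σ = coeff (s ∷ []) u
  θ = coeff (t ∷ []) u
  coeff-∷₂ : ∀ a b r → coeff (a ∷ b ∷ r) u ≡ coeff (a ∷ []) u + (coeff (b ∷ []) u + coeff r u)
  coeff-∷₂ a b r = trans (coeff-++ (a ∷ []) (b ∷ r) u) (cong (coeff (a ∷ []) u +_) (coeff-++ (b ∷ []) r u))
↭⇒≈ (↭.trans p↭q q↭r)         u = trans (↭⇒≈ p↭q u) (↭⇒≈ q↭r u)

cancel-++ : ∀ p q r → q ≈ r → p ++ q ++ scale (- 1ℚ) r ≈ p
cancel-++ p q r q≈r u = begin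
    coeff (p ++ q ++ scale (- 1ℚ) r) u
  ≡⟨ trans (coeff-++ p _ u) (cong (coeff p u +_) (coeff-++ q _ u)) ⟩
    coeff p u + (coeff q u + coeff (scale (- 1ℚ) r) u)
  ≡⟨ cong₂ (λ a b → coeff p u + (a + b)) (q≈r u) (coeff-scale (- 1ℚ) r u) ⟩
    coeff p u + (coeff r u + - 1ℚ * coeff r u)
  ≡⟨ solve 2 (λ a b → a :+ (b :+ (:- con 1ℚ) :* b) := a) refl (coeff p u) (coeff r u) ⟩
    coeff p u
  ∎
  where open ≡-Reasoning
        open +-*-Solver

-- Poly is an unnormalised list of terms, so this term-wise pairing has to be
-- shown to depend only on coefficients (⟪⟫-cong).
⟪_,_⟫ : Poly → (Word → ℚ) → ℚ
⟪ []          , G ⟫ = 0ℚ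
⟪ (c , w) ∷ p , G ⟫ = c * G w + ⟪ p , G ⟫

AgreeOnSupport : Poly → (Word → ℚ) → (Word → ℚ) → Set
AgreeOnSupport p G G′ = ∀ u → coeff p u ≢ 0ℚ → G u ≡ G′ u

without : Word → Poly → Poly
without w []            = []
without w ((c , v) ∷ p) with v ≟W w
... | yes _ = without w p
... | no  _ = (c , v) ∷ without w p

⟪⟫-without : ∀ p w G → ⟪ p , G ⟫ ≡ coeff p w * G w + ⟪ without w p , G ⟫
⟪⟫-without []            w G = sym (trans (cong (_+ 0ℚ) (ℚ.*-zeroˡ (G w))) (ℚ.+-identityˡ 0ℚ))
⟪⟫-without ((c , v) ∷ p) w G with v ≟W w
... | yes refl = trans (cong (c * G w +_) (⟪⟫-without p w G))
  (solve 4 (λ c g a b → c :* g :+ (a :* g :+ b) := (c :+ a) :* g :+ b) refl c (G w) (coeff p w) ⟪ without w p , G ⟫)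
  where open +-*-Solver
... | no  _    = trans (cong (c * G v +_) (⟪⟫-without p w G))
  (solve 3 (λ d a b → d :+ (a :+ b) := a :+ (d :+ b)) refl (c * G v) (coeff p w * G w) ⟪ without w p , G ⟫)
  where open +-*-Solver

coeff-without-self : ∀ w p → coeff (without w p) w ≡ 0ℚ
coeff-without-self w []            = refl
coeff-without-self w ((c , v) ∷ p) with v ≟W w
... | yes _ = coeff-without-self w p
... | no v≢w with v ≟W w
...   | yes v≡w = ⊥-elim (v≢w v≡w)
...   | no  _   = coeff-without-self w p

coeff-without-other : ∀ w p u → u ≢ w → coeff (without w p) u ≡ coeff p u
coeff-without-other w []            u u≢w = refl
coeff-without-other w ((c , v) ∷ p) u u≢w with v ≟W w
... | yes refl with v ≟W u
...   | yes refl = ⊥-elim (u≢w refl)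
...   | no  _    = coeff-without-other w p u u≢w
coeff-without-other w ((c , v) ∷ p) u u≢w | no _ with v ≟W u
...   | yes _ = cong (c +_) (coeff-without-other w p u u≢w)
...   | no  _ = coeff-without-other w p u u≢w

without-cong : ∀ w p q → p ≈ q → without w p ≈ without w q
without-cong w p q p≈q u with u ≟W w
... | yes refl = trans (coeff-without-self u p) (sym (coeff-without-self u q))
... | no  u≢w  = trans (coeff-without-other w p u u≢w) (trans (p≈q u) (sym (coeff-without-other w q u u≢w)))

without-agree : ∀ w p {G G′} → AgreeOnSupport p G G′ → AgreeOnSupport (without w p) G G′
without-agree w p agree u c≢0 with u ≟W w
... | yes refl = ⊥-elim (c≢0 (coeff-without-self u p))
... | no  u≢w  = agree u (λ c≡0 → c≢0 (trans (coeff-without-other w p u u≢w) c≡0))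

length-without : ∀ w p → length (without w p) ≤ length p
length-without w []            = z≤n
length-without w ((c , v) ∷ p) with v ≟W w
... | yes _ = ℕ.m≤n⇒m≤1+n (length-without w p)
... | no  _ = s≤s (length-without w p)

length-without-∷ : ∀ c w p → length (without w ((c , w) ∷ p)) ≤ length p
length-without-∷ c w p with w ≟W w
... | yes _   = length-without w p
... | no  w≢w = ⊥-elim (w≢w refl)

⟪⟫-cong : ∀ p q {G G′} → p ≈ q → AgreeOnSupport p G G′ → ⟪ p , G ⟫ ≡ ⟪ q , G′ ⟫
⟪⟫-cong p q {G} {G′} = go (length p +ℕ length q) p q ℕ.≤-refl
  where
  term-cong : ∀ w p q → p ≈ q → AgreeOnSupport p G G′ → coeff p w * G w ≡ coeff q w * G′ w
  term-cong w p q p≈q agree with coeff p w ℚ.≟ 0ℚ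
  ... | yes c≡0 = trans (cong (_* G w) c≡0)
                    (trans (ℚ.*-zeroˡ (G w)) (sym (trans (cong (_* G′ w) (trans (sym (p≈q w)) c≡0)) (ℚ.*-zeroˡ (G′ w)))))
  ... | no  c≢0 = cong₂ _*_ (p≈q w) (agree w c≢0)

  step : ∀ w p q → p ≈ q → AgreeOnSupport p G G′ →
         ⟪ without w p , G ⟫ ≡ ⟪ without w q , G′ ⟫ → ⟪ p , G ⟫ ≡ ⟪ q , G′ ⟫
  step w p q p≈q agree rest = trans (⟪⟫-without p w G)
    (trans (cong₂ _+_ (term-cong w p q p≈q agree) rest) (sym (⟪⟫-without q w G′)))

  go : ∀ n p q → length p +ℕ length q ≤ n → p ≈ q → AgreeOnSupport p G G′ → ⟪ p , G ⟫ ≡ ⟪ q , G′ ⟫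
  go n       []                 []                 _        _   _     = refl
  go (suc n) p@((c , w) ∷ p′)   q                  (s≤s le) p≈q agree =
    step w p q p≈q agree
      (go n (without w p) (without w q)
          (ℕ.≤-trans (ℕ.+-mono-≤ (length-without-∷ c w p′) (length-without w q)) le)
          (without-cong w p q p≈q) (without-agree w p agree))
  go (suc n) []                 q@((c , w) ∷ q′)   (s≤s le) p≈q agree =
    step w [] q p≈q agree
      (go n [] (without w q) (ℕ.≤-trans (length-without-∷ c w q′) le)
          (without-cong w [] q p≈q) (without-agree w [] agree))

⟪⟫-congˡ : ∀ p q {G} → p ≈ q → ⟪ p , G ⟫ ≡ ⟪ q , G ⟫
⟪⟫-congˡ p q p≈q = ⟪⟫-cong p q p≈q (λ _ _ → refl)

⟪⟫-congʳ : ∀ p {G G′} → AgreeOnSupport p G G′ → ⟪ p , G ⟫ ≡ ⟪ p , G′ ⟫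
⟪⟫-congʳ p = ⟪⟫-cong p p (λ _ → refl)

mapW : (Word → Word) → Poly → Poly
mapW h = map (map₂ h)

coeff-mapW : ∀ h p u → coeff (mapW h p) u ≡ ⟪ p , (λ w → coeff ((1ℚ , h w) ∷ []) u) ⟫
coeff-mapW h []            u = refl
coeff-mapW h ((c , w) ∷ p) u with h w ≟W u
... | yes _ = cong₂ _+_ (solve 1 (λ c → c := c :* (con 1ℚ :+ con 0ℚ)) refl c) (coeff-mapW h p u)
  where open +-*-Solver
... | no  _ = trans (coeff-mapW h p u) (solve 2 (λ c b → b := c :* con 0ℚ :+ b) refl c _)
  where open +-*-Solver

mapW-cong : ∀ h p q → p ≈ q → mapW h p ≈ mapW h q
mapW-cong h p q p≈q u = trans (coeff-mapW h p u) (trans (⟪⟫-congˡ p q p≈q) (sym (coeff-mapW h q u)))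

⟪⟫-mapW : ∀ h p G → ⟪ mapW h p , G ⟫ ≡ ⟪ p , (λ w → G (h w)) ⟫
⟪⟫-mapW h []            G = refl
⟪⟫-mapW h ((c , w) ∷ p) G = cong (c * G (h w) +_) (⟪⟫-mapW h p G)

coeff-mapW-involutive : ∀ h → (∀ w → h (h w) ≡ w) → ∀ p u → coeff (mapW h p) u ≡ coeff p (h u)
coeff-mapW-involutive h invol []            u = refl
coeff-mapW-involutive h invol ((c , w) ∷ p) u with h w ≟W u | w ≟W h u
... | yes _   | yes _   = cong (c +_) (coeff-mapW-involutive h invol p u)
... | no  _   | no  _   = coeff-mapW-involutive h invol p u
... | yes hw≡u | no w≢hu = ⊥-elim (w≢hu (trans (sym (invol w)) (cong h hw≡u)))
... | no  hw≢u | yes w≡hu = ⊥-elim (hw≢u (trans (cong h w≡hu) (invol u)))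

lmul-cong : ∀ s p q → p ≈ q → lmul s p ≈ lmul s q
lmul-cong s = mapW-cong (s ++_)

lmul-++ : ∀ s t p → lmul s (lmul t p) ≡ lmul (s ++ t) p
lmul-++ s t []            = refl
lmul-++ s t ((c , w) ∷ p) = cong₂ _∷_ (cong (c ,_) (sym (List.++-assoc s t w))) (lmul-++ s t p)

lmul-[] : ∀ p → lmul [] p ≡ p
lmul-[] []      = refl
lmul-[] (t ∷ p) = cong (t ∷_) (lmul-[] p)

bilin-coeff : ∀ f p q u → coeff (bilin f p q) u ≡ ⟪ p , (λ w → ⟪ q , (λ v → coeff (f w v) u) ⟫) ⟫
bilin-coeff f []            q u = refl
bilin-coeff f ((a , w) ∷ p) q u =
  trans (coeff-++ (concatMap _ q) (bilin f p q) u) (cong₂ _+_ (row q) (bilin-coeff f p q u))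
  where
  row : ∀ q → coeff (concatMap (λ { (b , v) → scale (a * b) (f w v) }) q) u
              ≡ a * ⟪ q , (λ v → coeff (f w v) u) ⟫
  row []            = sym (ℚ.*-zeroʳ a)
  row ((b , v) ∷ q) = trans (coeff-++ (scale (a * b) (f w v)) _ u)
    (trans (cong₂ _+_ (trans (coeff-scale (a * b) (f w v) u) (ℚ.*-assoc a b _)) (row q))
           (sym (ℚ.*-distribˡ-+ a _ _)))

τw-++ : ∀ u v → τw (u ++ v) ≡ τw v ++ τw u
τw-++ u v = trans (cong reverse (List.map-++ swapL u v)) (List.reverse-++ (map swapL u) (map swapL v))

swapL-involutive : ∀ a → swapL (swapL a) ≡ a
swapL-involutive x = refl
swapL-involutive y = refl

τw-involutive : ∀ w → τw (τw w) ≡ w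
τw-involutive w = begin
  reverse (map swapL (reverse (map swapL w)))  ≡⟨ cong reverse (List.reverse-map swapL (map swapL w)) ⟩
  reverse (reverse (map swapL (map swapL w)))  ≡⟨ List.reverse-involutive _ ⟩
  map swapL (map swapL w)                      ≡⟨ sym (List.map-∘ w) ⟩
  map (λ a → swapL (swapL a)) w                ≡⟨ List.map-cong swapL-involutive w ⟩
  map (λ a → a) w                              ≡⟨ List.map-id w ⟩
  w                                            ∎
  where open ≡-Reasoning

blockWord : List ℕ → Word
blockWord []      = []
blockWord (k ∷ K) = x ∷ replicate k y ++ blockWord K

y-blocks : ∀ w → ∃ λ n → ∃ λ K → w ≡ replicate n y ++ blockWord K
y-blocks []      = 0 , [] , refl
y-blocks (y ∷ w) with y-blocks w
... | n , K , refl = suc n , K , refl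
y-blocks (x ∷ w) with y-blocks w
... | n , K , refl = 0 , n ∷ K , refl

H0-blockWord : ∀ {w} → IsH0Word w → ∃ λ K → w ≡ blockWord K
H0-blockWord empty = [] , refl
H0-blockWord (xuy u) with y-blocks (u ++ y ∷ [])
... | n , K , eq = n ∷ K , cong (x ∷_) eq

⋄Sh-yˡ : ∀ b → ⋄Sh y b ≡ (- 1ℚ , b ∷ y ∷ [])
⋄Sh-yˡ x = refl
⋄Sh-yˡ y = refl

⋄Sh-yʳ : ∀ a → ⋄Sh a y ≡ (- 1ℚ , a ∷ y ∷ [])
⋄Sh-yʳ x = refl
⋄Sh-yʳ y = refl

-- Since y ⋄_Sh b = −b y, the diamond term cancels the term that takes b first.
shW-yˡ : ∀ w v → shW (y ∷ w) v ≈ lmul (y ∷ []) (shW w v)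
shW-yˡ []      []      _ = refl
shW-yˡ (_ ∷ _) []      _ = refl
shW-yˡ w       (b ∷ v) rewrite ⋄Sh-yˡ b =
  cancel-++ (lmul (y ∷ []) (shW w (b ∷ v))) (lmul (b ∷ []) (shW (y ∷ w) v)) (lmul (b ∷ y ∷ []) (shW w v)) (begin
    lmul (b ∷ []) (shW (y ∷ w) v)              ≈⟨ lmul-cong (b ∷ []) (shW (y ∷ w) v) (lmul (y ∷ []) (shW w v)) (shW-yˡ w v) ⟩
    lmul (b ∷ []) (lmul (y ∷ []) (shW w v))    ≡⟨ lmul-++ (b ∷ []) (y ∷ []) (shW w v) ⟩
    lmul (b ∷ y ∷ []) (shW w v)                ∎)
  where open SetoidReasoning ≈-setoid

shW-yʳ : ∀ w v → shW w (y ∷ v) ≈ lmul (y ∷ []) (shW w v)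
shW-yʳ []      v = λ _ → refl
shW-yʳ (a ∷ w) v rewrite ⋄Sh-yʳ a = begin
    lmul (a ∷ []) (shW w (y ∷ v)) ++ P ++ scale (- 1ℚ) (lmul (a ∷ y ∷ []) (shW w v))
  ≈⟨ ↭⇒≈ (shifts (lmul (a ∷ []) (shW w (y ∷ v))) P) ⟩
    P ++ lmul (a ∷ []) (shW w (y ∷ v)) ++ scale (- 1ℚ) (lmul (a ∷ y ∷ []) (shW w v))
  ≈⟨ cancel-++ P (lmul (a ∷ []) (shW w (y ∷ v))) (lmul (a ∷ y ∷ []) (shW w v)) (begin
       lmul (a ∷ []) (shW w (y ∷ v))              ≈⟨ lmul-cong (a ∷ []) (shW w (y ∷ v)) (lmul (y ∷ []) (shW w v)) (shW-yʳ w v) ⟩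
       lmul (a ∷ []) (lmul (y ∷ []) (shW w v))    ≡⟨ lmul-++ (a ∷ []) (y ∷ []) (shW w v) ⟩
       lmul (a ∷ y ∷ []) (shW w v)                ∎) ⟩
    P
  ∎
  where
  open SetoidReasoning ≈-setoid
  P : Poly
  P = lmul (y ∷ []) (shW (a ∷ w) v)

shW-yⁿˡ : ∀ n w v → shW (replicate n y ++ w) v ≈ lmul (replicate n y) (shW w v)
shW-yⁿˡ zero    w v = ≡⇒≈ (sym (lmul-[] (shW w v)))
shW-yⁿˡ (suc n) w v = begin
  shW (y ∷ replicate n y ++ w) v                     ≈⟨ shW-yˡ (replicate n y ++ w) v ⟩
  lmul (y ∷ []) (shW (replicate n y ++ w) v)
    ≈⟨ lmul-cong (y ∷ []) (shW (replicate n y ++ w) v) (lmul (replicate n y) (shW w v)) (shW-yⁿˡ n w v) ⟩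
  lmul (y ∷ []) (lmul (replicate n y) (shW w v))     ≡⟨ lmul-++ (y ∷ []) (replicate n y) (shW w v) ⟩
  lmul (replicate (suc n) y) (shW w v)               ∎
  where open SetoidReasoning ≈-setoid

shW-yⁿʳ : ∀ n w v → shW w (replicate n y ++ v) ≈ lmul (replicate n y) (shW w v)
shW-yⁿʳ zero    w v = ≡⇒≈ (sym (lmul-[] (shW w v)))
shW-yⁿʳ (suc n) w v = begin
  shW w (y ∷ replicate n y ++ v)                     ≈⟨ shW-yʳ w (replicate n y ++ v) ⟩
  lmul (y ∷ []) (shW w (replicate n y ++ v))
    ≈⟨ lmul-cong (y ∷ []) (shW w (replicate n y ++ v)) (lmul (replicate n y) (shW w v)) (shW-yⁿʳ n w v) ⟩
  lmul (y ∷ []) (lmul (replicate n y) (shW w v))     ≡⟨ lmul-++ (y ∷ []) (replicate n y) (shW w v) ⟩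
  lmul (replicate (suc n) y) (shW w v)               ∎
  where open SetoidReasoning ≈-setoid

shW-yⁿ-yⁿ : ∀ m n w v → shW (replicate m y ++ w) (replicate n y ++ v) ≈ lmul (replicate (m +ℕ n) y) (shW w v)
shW-yⁿ-yⁿ m n w v = begin
    shW (replicate m y ++ w) (replicate n y ++ v)              ≈⟨ shW-yⁿˡ m w (replicate n y ++ v) ⟩
    lmul (replicate m y) (shW w (replicate n y ++ v))
      ≈⟨ lmul-cong (replicate m y) (shW w (replicate n y ++ v)) (lmul (replicate n y) (shW w v)) (shW-yⁿʳ n w v) ⟩
    lmul (replicate m y) (lmul (replicate n y) (shW w v))      ≡⟨ lmul-++ (replicate m y) (replicate n y) (shW w v) ⟩
    lmul (replicate m y ++ replicate n y) (shW w v)            ≡⟨ cong (λ s → lmul s (shW w v)) (sym (replicate-+ m n y)) ⟩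
    lmul (replicate (m +ℕ n) y) (shW w v)                      ∎
  where open SetoidReasoning ≈-setoid

blockSum : List (List ℕ) → Poly
blockSum = map (λ K → (1ℚ , blockWord K))

lmul-x-yⁿ-blockSum : ∀ n p S → p ≈ lmul (replicate n y) (blockSum S) → lmul (x ∷ []) p ≈ blockSum (map (n ∷_) S)
lmul-x-yⁿ-blockSum n p S p≈ = begin
    lmul (x ∷ []) p                                      ≈⟨ lmul-cong (x ∷ []) p (lmul (replicate n y) (blockSum S)) p≈ ⟩
    lmul (x ∷ []) (lmul (replicate n y) (blockSum S))    ≡⟨ lmul-++ (x ∷ []) (replicate n y) (blockSum S) ⟩
    lmul (x ∷ replicate n y) (blockSum S)                ≡⟨ prefix S ⟩
    blockSum (map (n ∷_) S)                              ∎
  where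
  open SetoidReasoning ≈-setoid
  prefix : ∀ S → lmul (x ∷ replicate n y) (blockSum S) ≡ blockSum (map (n ∷_) S)
  prefix []      = refl
  prefix (K ∷ S) = cong (_ ∷_) (prefix S)

-- x ⋄_Sh x = x y merges the blocks x yᵃ and x yᵇ into x y^(a+b+1).
_⊕_ : ℕ → ℕ → ℕ
i ⊕ j = suc (i +ℕ j)

shW-blockWord-∷ : ∀ a K b L →
  shW (blockWord K) (blockWord (b ∷ L)) ≈ blockSum (qsh _⊕_ K (b ∷ L)) →
  shW (blockWord (a ∷ K)) (blockWord L) ≈ blockSum (qsh _⊕_ (a ∷ K) L) →
  shW (blockWord K) (blockWord L) ≈ blockSum (qsh _⊕_ K L) →
  shW (blockWord (a ∷ K)) (blockWord (b ∷ L)) ≈ blockSum (qsh _⊕_ (a ∷ K) (b ∷ L))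
shW-blockWord-∷ a K b L ih₁ ih₂ ih₃ = begin
    lmul (x ∷ []) T₁ ++ lmul (x ∷ []) T₂ ++ scale 1ℚ (lmul (x ∷ y ∷ []) T₃)
  ≈⟨ ++-cong (lmul (x ∷ []) T₁) (blockSum (map (a ∷_) Q₁)) _ _ first
       (++-cong (lmul (x ∷ []) T₂) (blockSum (map (b ∷_) Q₂)) _ (blockSum (map (a ⊕ b ∷_) Q₃)) second third) ⟩
    blockSum (map (a ∷_) Q₁) ++ blockSum (map (b ∷_) Q₂) ++ blockSum (map (a ⊕ b ∷_) Q₃)
  ≡⟨ sym (map-++₃ (λ K → (1ℚ , blockWord K)) (map (a ∷_) Q₁) (map (b ∷_) Q₂) (map (a ⊕ b ∷_) Q₃)) ⟩
    blockSum (qsh _⊕_ (a ∷ K) (b ∷ L))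
  ∎
  where
  open SetoidReasoning ≈-setoid
  T₁ T₂ T₃ : Poly
  T₁ = shW (replicate a y ++ blockWord K) (blockWord (b ∷ L))
  T₂ = shW (blockWord (a ∷ K)) (replicate b y ++ blockWord L)
  T₃ = shW (replicate a y ++ blockWord K) (replicate b y ++ blockWord L)
  Q₁ Q₂ Q₃ : List (List ℕ)
  Q₁ = qsh _⊕_ K (b ∷ L)
  Q₂ = qsh _⊕_ (a ∷ K) L
  Q₃ = qsh _⊕_ K L

  first : lmul (x ∷ []) T₁ ≈ blockSum (map (a ∷_) Q₁)
  first = lmul-x-yⁿ-blockSum a T₁ Q₁ (begin
    T₁                                                          ≈⟨ shW-yⁿˡ a (blockWord K) (blockWord (b ∷ L)) ⟩
    lmul (replicate a y) (shW (blockWord K) (blockWord (b ∷ L)))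
      ≈⟨ lmul-cong (replicate a y) (shW (blockWord K) (blockWord (b ∷ L))) (blockSum Q₁) ih₁ ⟩
    lmul (replicate a y) (blockSum Q₁)                          ∎)

  second : lmul (x ∷ []) T₂ ≈ blockSum (map (b ∷_) Q₂)
  second = lmul-x-yⁿ-blockSum b T₂ Q₂ (begin
    T₂                                                          ≈⟨ shW-yⁿʳ b (blockWord (a ∷ K)) (blockWord L) ⟩
    lmul (replicate b y) (shW (blockWord (a ∷ K)) (blockWord L))
      ≈⟨ lmul-cong (replicate b y) (shW (blockWord (a ∷ K)) (blockWord L)) (blockSum Q₂) ih₂ ⟩
    lmul (replicate b y) (blockSum Q₂)                          ∎)

  T₃≈ : T₃ ≈ lmul (replicate (a +ℕ b) y) (blockSum Q₃)
  T₃≈ = begin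
    T₃                                                 ≈⟨ shW-yⁿ-yⁿ a b (blockWord K) (blockWord L) ⟩
    lmul (replicate (a +ℕ b) y) (shW (blockWord K) (blockWord L))
      ≈⟨ lmul-cong (replicate (a +ℕ b) y) (shW (blockWord K) (blockWord L)) (blockSum Q₃) ih₃ ⟩
    lmul (replicate (a +ℕ b) y) (blockSum Q₃)          ∎

  third : scale 1ℚ (lmul (x ∷ y ∷ []) T₃) ≈ blockSum (map (a ⊕ b ∷_) Q₃)
  third = begin
    scale 1ℚ (lmul (x ∷ y ∷ []) T₃)         ≈⟨ scale-identity (lmul (x ∷ y ∷ []) T₃) ⟩
    lmul (x ∷ y ∷ []) T₃                    ≡⟨ sym (lmul-++ (x ∷ []) (y ∷ []) T₃) ⟩
    lmul (x ∷ []) (lmul (y ∷ []) T₃)        ≈⟨ lmul-x-yⁿ-blockSum (a ⊕ b) (lmul (y ∷ []) T₃) Q₃ (begin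
        lmul (y ∷ []) T₃
          ≈⟨ lmul-cong (y ∷ []) T₃ (lmul (replicate (a +ℕ b) y) (blockSum Q₃)) T₃≈ ⟩
        lmul (y ∷ []) (lmul (replicate (a +ℕ b) y) (blockSum Q₃))      ≡⟨ lmul-++ (y ∷ []) (replicate (a +ℕ b) y) (blockSum Q₃) ⟩
        lmul (replicate (a ⊕ b) y) (blockSum Q₃)                       ∎) ⟩
    blockSum (map (a ⊕ b ∷_) Q₃)            ∎

shW-blockWord : ∀ K L → shW (blockWord K) (blockWord L) ≈ blockSum (qsh _⊕_ K L)
shW-blockWord []      L       = λ _ → refl
shW-blockWord (a ∷ K) []      = λ _ → refl
shW-blockWord (a ∷ K) (b ∷ L) =
  shW-blockWord-∷ a K b L (shW-blockWord K (b ∷ L)) (shW-blockWord (a ∷ K) L) (shW-blockWord K L)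

τw-x-yⁿ : ∀ n → τw (x ∷ replicate n y) ≡ z (suc n)
τw-x-yⁿ n = begin
  reverse (y ∷ map swapL (replicate n y))  ≡⟨ cong (λ w → reverse (y ∷ w)) (List.map-replicate swapL n y) ⟩
  reverse (y ∷ replicate n x)              ≡⟨ List.unfold-reverse y (replicate n x) ⟩
  reverse (replicate n x) ∷ʳ y             ≡⟨ cong (_∷ʳ y) (reverse-replicate n x) ⟩
  replicate n x ∷ʳ y                       ∎
  where open ≡-Reasoning

zs-++ : ∀ M N → zs (M ++ N) ≡ zs M ++ zs N
zs-++ []      N = refl
zs-++ (k ∷ M) N = trans (cong (z k ++_) (zs-++ M N)) (sym (List.++-assoc (z k) (zs M) (zs N)))

τw-blockWord : ∀ K → τw (blockWord K) ≡ zs (map suc (reverse K))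
τw-blockWord []      = refl
τw-blockWord (k ∷ K) = begin
  τw ((x ∷ replicate k y) ++ blockWord K)            ≡⟨ τw-++ (x ∷ replicate k y) (blockWord K) ⟩
  τw (blockWord K) ++ τw (x ∷ replicate k y)         ≡⟨ cong₂ _++_ (τw-blockWord K) (τw-x-yⁿ k) ⟩
  zs (map suc (reverse K)) ++ z (suc k)              ≡⟨ cong (zs (map suc (reverse K)) ++_) (sym (List.++-identityʳ (z (suc k)))) ⟩
  zs (map suc (reverse K)) ++ zs (suc k ∷ [])        ≡⟨ sym (zs-++ (map suc (reverse K)) (suc k ∷ [])) ⟩
  zs (map suc (reverse K) ++ suc k ∷ [])             ≡⟨ cong zs (sym (List.map-++ suc (reverse K) (k ∷ []))) ⟩
  zs (map suc (reverse K ∷ʳ k))                      ≡⟨ cong (zs ∘ map suc) (sym (List.unfold-reverse k K)) ⟩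
  zs (map suc (reverse (k ∷ K)))                     ∎
  where open ≡-Reasoning

parse-xⁿy : ∀ n w M → parse w ≡ just M → parse (replicate n x ++ y ∷ w) ≡ just (suc n ∷ M)
parse-xⁿy zero    w M eq rewrite eq = refl
parse-xⁿy (suc n) w M eq rewrite parse-xⁿy n w M eq = refl

parse-zs : ∀ M → parse (zs (map suc M)) ≡ just (map suc M)
parse-zs []      = refl
parse-zs (k ∷ M) = trans (cong parse (List.++-assoc (replicate k x) (y ∷ []) (zs (map suc M))))
                         (parse-xⁿy k (zs (map suc M)) (map suc M) (parse-zs M))

stZ≡qsh : ∀ M N → stZ M N ≡ map (1ℚ ,_) (qsh _+ℕ_ M N)
stZ≡qsh []      N       = refl
stZ≡qsh (i ∷ M) []      = refl
stZ≡qsh (i ∷ M) (j ∷ N) = begin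
    map (map₂ (i ∷_)) (stZ M (j ∷ N)) ++ map (map₂ (j ∷_)) (stZ (i ∷ M) N) ++ map (map₂ (i +ℕ j ∷_)) (stZ M N)
  ≡⟨ cong₂ _++_ (cong (map (map₂ (i ∷_))) (stZ≡qsh M (j ∷ N)))
       (cong₂ _++_ (cong (map (map₂ (j ∷_))) (stZ≡qsh (i ∷ M) N)) (cong (map (map₂ (i +ℕ j ∷_))) (stZ≡qsh M N))) ⟩
    map (map₂ (i ∷_)) (map (1ℚ ,_) (qsh _+ℕ_ M (j ∷ N))) ++ map (map₂ (j ∷_)) (map (1ℚ ,_) (qsh _+ℕ_ (i ∷ M) N))
      ++ map (map₂ (i +ℕ j ∷_)) (map (1ℚ ,_) (qsh _+ℕ_ M N))
  ≡⟨ cong₂ _++_ (tag-cons i (qsh _+ℕ_ M (j ∷ N)))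
       (cong₂ _++_ (tag-cons j (qsh _+ℕ_ (i ∷ M) N)) (tag-cons (i +ℕ j) (qsh _+ℕ_ M N))) ⟩
    map (1ℚ ,_) (map (i ∷_) (qsh _+ℕ_ M (j ∷ N))) ++ map (1ℚ ,_) (map (j ∷_) (qsh _+ℕ_ (i ∷ M) N))
      ++ map (1ℚ ,_) (map (i +ℕ j ∷_) (qsh _+ℕ_ M N))
  ≡⟨ sym (map-++₃ (1ℚ ,_) (map (i ∷_) (qsh _+ℕ_ M (j ∷ N))) (map (j ∷_) (qsh _+ℕ_ (i ∷ M) N))
                          (map (i +ℕ j ∷_) (qsh _+ℕ_ M N))) ⟩
    map (1ℚ ,_) (qsh _+ℕ_ (i ∷ M) (j ∷ N))
  ∎
  where
  open ≡-Reasoning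
  tag-cons : ∀ k S → map (map₂ (k ∷_)) (map (1ℚ ,_) S) ≡ map (1ℚ ,_) (map (k ∷_) S)
  tag-cons k S = trans (sym (List.map-∘ S)) (List.map-∘ S)

stW-zs : ∀ M N → stW (zs (map suc M)) (zs (map suc N)) ≡ map (λ t → (1ℚ , zs t)) (qsh _+ℕ_ (map suc M) (map suc N))
stW-zs M N rewrite parse-zs M | parse-zs N =
  trans (cong (map (map₂ zs)) (stZ≡qsh (map suc M) (map suc N))) (sym (List.map-∘ _))

τ-stW-τw-blockWord : ∀ K L → τ (stW (τw (blockWord K)) (τw (blockWord L))) ≈ shW (blockWord K) (blockWord L)
τ-stW-τw-blockWord K L = begin
    τ (stW (τw (blockWord K)) (τw (blockWord L)))
  ≡⟨ cong₂ (λ a b → τ (stW a b)) (τw-blockWord K) (τw-blockWord L) ⟩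
    τ (stW (zs (map suc (reverse K))) (zs (map suc (reverse L))))
  ≡⟨ cong τ (stW-zs (reverse K) (reverse L)) ⟩
    τ (map (λ t → (1ℚ , zs t)) (qsh _+ℕ_ (map suc (reverse K)) (map suc (reverse L))))
  ≡⟨ cong (τ ∘ map (λ t → (1ℚ , zs t))) (qsh-map suc (λ i j → cong suc (sym (ℕ.+-suc i j))) (reverse K) (reverse L)) ⟩
    τ (map (λ t → (1ℚ , zs t)) (map (map suc) (qsh _⊕_ (reverse K) (reverse L))))
  ≡⟨ trans (cong τ (sym (List.map-∘ _))) (sym (List.map-∘ _)) ⟩
    map τ-block (qsh _⊕_ (reverse K) (reverse L))
  ≈⟨ ↭⇒≈ (map⁺ τ-block (qsh-reverse _⊕_ K L)) ⟩
    map τ-block (map reverse (qsh _⊕_ K L))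
  ≡⟨ trans (sym (List.map-∘ (qsh _⊕_ K L))) (List.map-cong τ-block-reverse (qsh _⊕_ K L)) ⟩
    blockSum (qsh _⊕_ K L)
  ≈⟨ (λ u → sym (shW-blockWord K L u)) ⟩
    shW (blockWord K) (blockWord L)
  ∎
  where
  open SetoidReasoning ≈-setoid
  τ-block : List ℕ → ℚ × Word
  τ-block M = (1ℚ , τw (zs (map suc M)))
  τ-block-reverse : ∀ M → τ-block (reverse M) ≡ (1ℚ , blockWord M)
  τ-block-reverse M = cong (1ℚ ,_) (trans (cong τw (sym (τw-blockWord M))) (τw-involutive (blockWord M)))

stW-τw-H0 : ∀ {a b} → IsH0Word a → IsH0Word b → ∀ u → coeff (stW (τw a) (τw b)) (τw u) ≡ coeff (shW a b) u
stW-τw-H0 a∈H⁰ b∈H⁰ u with H0-blockWord a∈H⁰ | H0-blockWord b∈H⁰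
... | K , refl | L , refl =
  trans (sym (coeff-mapW-involutive τw τw-involutive (stW (τw (blockWord K)) (τw (blockWord L))) u))
        (τ-stW-τw-blockWord K L u)

corollary3p24 : (w v : Poly) → InH0 w → InH0 v → τ (τ w ✶ τ v) ≈ w ⧢Sh v
corollary3p24 w v w∈H⁰ v∈H⁰ u = begin
    coeff (τ (τ w ✶ τ v)) u
  ≡⟨ coeff-mapW-involutive τw τw-involutive (τ w ✶ τ v) u ⟩
    coeff (τ w ✶ τ v) (τw u)
  ≡⟨ bilin-coeff stW (τ w) (τ v) (τw u) ⟩
    ⟪ τ w , (λ a → ⟪ τ v , (λ b → coeff (stW a b) (τw u)) ⟫) ⟫
  ≡⟨ ⟪⟫-mapW τw w _ ⟩
    ⟪ w , (λ a → ⟪ τ v , (λ b → coeff (stW (τw a) b) (τw u)) ⟫) ⟫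
  ≡⟨ ⟪⟫-congʳ w (λ a _ → ⟪⟫-mapW τw v _) ⟩
    ⟪ w , (λ a → ⟪ v , (λ b → coeff (stW (τw a) (τw b)) (τw u)) ⟫) ⟫
  ≡⟨ ⟪⟫-congʳ w (λ a a≠0 → ⟪⟫-congʳ v (λ b b≠0 → stW-τw-H0 (w∈H⁰ a a≠0) (v∈H⁰ b b≠0) u)) ⟩
    ⟪ w , (λ a → ⟪ v , (λ b → coeff (shW a b) u) ⟫) ⟫
  ≡⟨ sym (bilin-coeff shW w v u) ⟩
    coeff (w ⧢Sh v) u
  ∎
  where open ≡-Reasoning
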